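{- Let $p,q$ be two different odd primes and let $A=\{n\in\mathbb{N}: \gcd\big(pq,\binom{2n}{n}\big)=1\}$. Then there is a constant $c>0$ depending on $p,q$ such that $\#(A\cap[1,N])\geq c\log N$ for all sufficiently large integers $N$.
   Context: $\mathbb{N}$ denotes the set of positive integers. -}

module Defs where

open import Data.Nat using (ℕ; suc; _*_; _≟_)
open import Data.Nat.GCD using (gcd)
open import Data.Nat.Combinatorics using (_C_)
open import Data.List using (List; length; filter; upTo; map)

countA : ℕ → ℕ → ℕ → ℕ
countA p q N = length (filter (λ n → gcd (p * q) ((2 * n) C n) ≟ 1) (map suc (upTo N)))

{-# OPTIONS --safe #-}
-- Write p = 2h + 1. If every base-p digit of n is at most h, then n + n has no carries in
-- base p, so p ∤ C(2n, n) by Kummer's theorem; here this is shown directly: (2n)! and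
-- n! · n! contain the same power of p. These n form a Cantor-like set whose level-j gaps have
-- length R_j + 1, where R_j = h (1 + p + ⋯ + p^(j-1)), and this length at least doubles
-- from one level to the next. Given interleaved gaps of the sets for p and for q, probing an
-- endpoint of the shorter gap in the other set either finds a common element or yields a new
-- interleaved pair of lower total level; the total drift is bounded by the two initial gap
-- lengths. Starting near p^l this gives, for p ≥ 5, a common element in [p^l / 4, 6 p^l] for
-- every l, hence at least c log N elements of A in [1, N].
module Submission where

open import Defs
open import Data.Nat
open import Data.Nat.Properties
open import Data.Nat.Divisibility
open import Data.Nat.Primality
open import Data.Nat.Coprimality using (Coprime; coprime⇒gcd≡1; coprime-divisor)
open import Data.Nat.GCD using (gcd)
open import Data.Nat.Combinatorics using (_C_; nCk≡n!/k![n-k]!; k![n∸k]!∣n!)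
open import Data.Nat.DivMod using (_/_; _%_; m/n*n≡m; m≡m%n+[m/n]*n; m%n<n; m≥n⇒m/n>0)
open import Data.Nat.Logarithm
open import Data.Nat.Induction using (<-rec)
open import Data.Nat.Tactic.RingSolver using (solve-∀)
open import Data.List using (length; filter; upTo; map; _++_; [_])
open import Data.List.Properties using (applyUpTo-∷ʳ; map-++; filter-++; length-++; filter-accept)
open import Data.Product using (Σ; ∃-syntax; _×_; _,_; proj₁; proj₂; swap; map₁; map₂)
open import Data.Sum using (_⊎_; inj₁; inj₂; [_,_]′)
open import Data.Empty using (⊥-elim)
open import Function using (_∘_)
open import Level using (0ℓ)
open import Relation.Unary using (Pred; Decidable)
open import Relation.Binary.PropositionalEquality hiding ([_])
open import Relation.Nullary using (¬_; yes; no; contradiction)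

module _ {p : ℕ} (p-prime : Prime p) where

  prime∤1 : p ∤ 1
  prime∤1 = >⇒∤ (nonTrivial⇒n>1 p {{prime⇒nonTrivial p-prime}})

  prime∤-* : ∀ {m n} → p ∤ m → p ∤ n → p ∤ m * n
  prime∤-* {m} {n} p∤m p∤n p∣mn = [ p∤m , p∤n ]′ (euclidsLemma m n p-prime p∣mn)

  prime∤⇒coprime : ∀ {n} → p ∤ n → Coprime p n
  prime∤⇒coprime p∤n (i∣p , i∣n) with prime⇒irreducible p-prime i∣p
  ... | inj₁ i≡1 = i≡1
  ... | inj₂ refl = contradiction i∣n p∤n

coprime-*ˡ : ∀ {m n o} → Coprime m o → Coprime n o → Coprime (m * n) o
coprime-*ˡ {m} {n} m⊥o n⊥o {i} (i∣mn , i∣o) = n⊥o (coprime-divisor i⊥m i∣mn , i∣o)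
  where
  i⊥m : Coprime i m
  i⊥m (j∣i , j∣m) = m⊥o (j∣m , ∣-trans j∣i i∣o)

module _ {P : Pred ℕ 0ℓ} (P? : Decidable P) where

  count : ℕ → ℕ
  count N = length (filter P? (map suc (upTo N)))

  count-suc : ∀ N → count (suc N) ≡ count N + length (filter P? [ suc N ])
  count-suc N = begin
    length (filter P? (map suc (upTo (suc N))))               ≡⟨ cong (λ l → length (filter P? l)) upTo-suc ⟩
    length (filter P? (map suc (upTo N) ++ [ suc N ]))        ≡⟨ cong length (filter-++ P? (map suc (upTo N)) [ suc N ]) ⟩
    length (filter P? (map suc (upTo N)) ++ filter P? [ suc N ]) ≡⟨ length-++ (filter P? (map suc (upTo N))) ⟩
    count N + length (filter P? [ suc N ])                    ∎
    where
    open ≡-Reasoning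
    upTo-suc : map suc (upTo (suc N)) ≡ map suc (upTo N) ++ [ suc N ]
    upTo-suc = trans (cong (map suc) (sym (applyUpTo-∷ʳ (λ x → x) N))) (map-++ suc (upTo N) [ N ])

  count-≤-suc : ∀ N → count N ≤ count (suc N)
  count-≤-suc N = subst (count N ≤_) (sym (count-suc N)) (m≤m+n _ _)

  count-mono : ∀ {N M} → N ≤ M → count N ≤ count M
  count-mono N≤M = go (≤⇒≤′ N≤M)
    where
    go : ∀ {N M} → N ≤′ M → count N ≤ count M
    go ≤′-refl = ≤-refl
    go (≤′-step {M} N≤′M) = ≤-trans (go N≤′M) (count-≤-suc M)

  count-accept : ∀ {m} → P (suc m) → count (suc m) ≡ suc (count m)
  count-accept {m} Pm = begin
    count (suc m)                           ≡⟨ count-suc m ⟩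
    count m + length (filter P? [ suc m ])  ≡⟨ cong (λ l → count m + length l) (filter-accept P? Pm) ⟩
    count m + 1                             ≡⟨ +-comm (count m) 1 ⟩
    suc (count m)                           ∎
    where open ≡-Reasoning

  count-member : ∀ {m N} → P (suc m) → suc m ≤ N → suc (count m) ≤ count N
  count-member {N = N} Pm m<N = subst (_≤ count N) (count-accept Pm) (count-mono m<N)

  increasing⇒count : (x : ℕ → ℕ) → (∀ k → P (x k)) → (∀ k → x k < x (suc k)) → 0 < x 0 →
                     ∀ k {N} → x k ≤ N → suc k ≤ count N
  increasing⇒count x P[x] x-inc 0<x₀ zero x₀≤N with x 0 | P[x] 0 | 0<x₀
  ... | suc _ | Px₀ | _ = ≤-trans (s≤s z≤n) (count-member Px₀ x₀≤N)
  increasing⇒count x P[x] x-inc 0<x₀ (suc k) xₖ₊₁≤N with x (suc k) | P[x] (suc k) | x-inc k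
  ... | suc y | Pxₖ₊₁ | xₖ<xₖ₊₁ =
    ≤-trans (s≤s (increasing⇒count x P[x] x-inc 0<x₀ k (≤-pred xₖ<xₖ₊₁))) (count-member Pxₖ₊₁ xₖ₊₁≤N)

2^⌊log₂n⌋≤n : ∀ n .{{_ : NonZero n}} → 2 ^ ⌊log₂ n ⌋ ≤ n
2^⌊log₂n⌋≤n = <-rec (λ n → .{{NonZero n}} → 2 ^ ⌊log₂ n ⌋ ≤ n) step
  where
  step : ∀ n → (∀ {m} → m < n → .{{NonZero m}} → 2 ^ ⌊log₂ m ⌋ ≤ m) → .{{NonZero n}} → 2 ^ ⌊log₂ n ⌋ ≤ n
  step 1 _ = ≤-refl
  step n@(suc (suc k)) rec = subst (_≤ n) (cong (2 ^_) (sym ⌊log₂n⌋≡1+⌊log₂⌊n/2⌋⌋)) (begin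
    2 * 2 ^ ⌊log₂ ⌊ n /2⌋ ⌋   ≤⟨ *-monoʳ-≤ 2 (rec (⌊n/2⌋<n (suc k))) ⟩
    2 * ⌊ n /2⌋               ≡⟨ cong (⌊ n /2⌋ +_) (+-identityʳ ⌊ n /2⌋) ⟩
    ⌊ n /2⌋ + ⌊ n /2⌋         ≤⟨ +-monoʳ-≤ ⌊ n /2⌋ (⌊n/2⌋≤⌈n/2⌉ n) ⟩
    ⌊ n /2⌋ + ⌈ n /2⌉         ≡⟨ ⌊n/2⌋+⌈n/2⌉≡n n ⟩
    n                         ∎)
    where
    open ≤-Reasoning
    suc[m∸1]≡m : ∀ {m} → 1 ≤ m → suc (m ∸ 1) ≡ m
    suc[m∸1]≡m (s≤s _) = refl
    ⌊log₂n⌋≡1+⌊log₂⌊n/2⌋⌋ : ⌊log₂ n ⌋ ≡ suc ⌊log₂ ⌊ n /2⌋ ⌋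
    ⌊log₂n⌋≡1+⌊log₂⌊n/2⌋⌋ = trans (sym (suc[m∸1]≡m (⌊log₂⌋-mono-≤ {2} {n} (s≤s (s≤s z≤n)))))
                                   (cong suc (sym (⌊log₂⌊n/2⌋⌋≡⌊log₂n⌋∸1 n)))

⌊log₂⌋≤-from-exponential-growth : ∀ s .{{_ : NonZero s}} (c : ℕ → ℕ) →
  (∀ k {N} → 2 ^ (s * suc k) ≤ N → suc k ≤ c N) →
  ∀ {N} → 2 ^ s ≤ N → ⌊log₂ N ⌋ ≤ 2 * s * c N
⌊log₂⌋≤-from-exponential-growth s c grows {N} 2^s≤N
  with ⌊log₂ N ⌋ / s | m≥n⇒m/n>0 s≤L | m≡m%n+[m/n]*n ⌊log₂ N ⌋ s
  where
  s≤L : s ≤ ⌊log₂ N ⌋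
  s≤L = subst (_≤ ⌊log₂ N ⌋) (⌊log₂[2^n]⌋≡n s) (⌊log₂⌋-mono-≤ 2^s≤N)
... | suc k | _ | L≡r+[k+1]s = begin
  ⌊log₂ N ⌋                   ≡⟨ L≡r+[k+1]s ⟩
  ⌊log₂ N ⌋ % s + suc k * s   ≤⟨ +-monoˡ-≤ (suc k * s) (<⇒≤ (m%n<n ⌊log₂ N ⌋ s)) ⟩
  s + suc k * s               ≤⟨ +-monoˡ-≤ (suc k * s) (m≤n*m s (suc k)) ⟩
  suc k * s + suc k * s       ≡⟨ rearrange k s ⟩
  2 * s * suc k               ≤⟨ *-monoʳ-≤ (2 * s) (grows k 2^[s[k+1]]≤N) ⟩
  2 * s * c N                 ∎
  where
  open ≤-Reasoning
  rearrange : ∀ k s → suc k * s + suc k * s ≡ 2 * s * suc k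
  rearrange = solve-∀
  s[k+1]≤L : s * suc k ≤ ⌊log₂ N ⌋
  s[k+1]≤L = ≤-trans (≤-reflexive (*-comm s (suc k))) (≤-trans (m≤n+m (suc k * s) (⌊log₂ N ⌋ % s)) (≤-reflexive (sym L≡r+[k+1]s)))
  2^[s[k+1]]≤N : 2 ^ (s * suc k) ≤ N
  2^[s[k+1]]≤N = ≤-trans (^-monoʳ-≤ 2 s[k+1]≤L) (2^⌊log₂n⌋≤n N {{>-nonZero (≤-trans (m^n>0 2 s) 2^s≤N)}})

n<2^n : ∀ n → n < 2 ^ n
n<2^n zero    = s≤s z≤n
n<2^n (suc n) = +-mono-≤ (m^n>0 2 n) (≤-trans (n<2^n n) (m≤m+n (2 ^ n) 0))

-- T ≥ 125 > 4 · 6 makes the windows [T^(k+1) / 4, 6 T^(k+1)] pairwise disjoint, so the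
-- witnesses increase.
module _ {P : Pred ℕ 0ℓ} (P? : Decidable P) {T : ℕ} (125≤T : 125 ≤ T)
         (witness : ∀ k → ∃[ n ] P n × T ^ suc k ≤ 4 * suc n × n ≤ 6 * T ^ suc k) where

  private
    x : ℕ → ℕ
    x k = proj₁ (witness k)

    P[x] : ∀ k → P (x k)
    P[x] k = proj₁ (proj₂ (witness k))

    T^k≤4[x+1] : ∀ k → T ^ suc k ≤ 4 * suc (x k)
    T^k≤4[x+1] k = proj₁ (proj₂ (proj₂ (witness k)))

    x≤6T^k : ∀ k → x k ≤ 6 * T ^ suc k
    x≤6T^k k = proj₂ (proj₂ (proj₂ (witness k)))

    x-increasing : ∀ k → x k < x (suc k)
    x-increasing k = ≤-pred (*-cancelˡ-< 4 _ _ (begin-strict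
      4 * suc (x k)                 ≤⟨ *-monoʳ-≤ 4 (s≤s (x≤6T^k k)) ⟩
      4 * suc (6 * T ^ suc k)       <⟨ 4[6t+1]<125t (T ^ suc k) (m^n>0 T {{T≢0}} (suc k)) ⟩
      125 * T ^ suc k               ≤⟨ *-monoˡ-≤ (T ^ suc k) 125≤T ⟩
      T ^ suc (suc k)               ≤⟨ T^k≤4[x+1] (suc k) ⟩
      4 * suc (x (suc k))           ∎))
      where
      open ≤-Reasoning
      T≢0 : NonZero T
      T≢0 = >-nonZero (≤-trans (s≤s z≤n) 125≤T)
      4[6t+1]<125t : ∀ t → 1 ≤ t → suc (4 * suc (6 * t)) ≤ 125 * t
      4[6t+1]<125t (suc t) _ = ≤-trans (m≤m+n _ (96 + 101 * t)) (≤-reflexive (rearrange t))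
        where
        rearrange : ∀ t → suc (4 * suc (6 * suc t)) + (96 + 101 * t) ≡ 125 * suc t
        rearrange = solve-∀

    x-positive : 0 < x 0
    x-positive = ≤-pred (*-cancelˡ-< 4 1 (suc (x 0)) (begin-strict
      4 * 1                 <⟨ m≤m+n 5 120 ⟩
      125                   ≤⟨ 125≤T ⟩
      T                     ≡⟨ sym (*-identityʳ T) ⟩
      T ^ 1                 ≤⟨ T^k≤4[x+1] 0 ⟩
      4 * suc (x 0)         ∎))
      where open ≤-Reasoning

    6T^k≤[6T]^k : ∀ k → 6 * T ^ suc k ≤ (6 * T) ^ suc k
    6T^k≤[6T]^k zero    = ≤-reflexive (sym (*-assoc 6 T 1))
    6T^k≤[6T]^k (suc k) = begin
      6 * (T * T ^ suc k)      ≡⟨ x*[y*z]≡y*[x*z] 6 T (T ^ suc k) ⟩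
      T * (6 * T ^ suc k)      ≤⟨ *-mono-≤ (m≤n*m T 6) (6T^k≤[6T]^k k) ⟩
      6 * T * (6 * T) ^ suc k  ∎
      where
      open ≤-Reasoning
      x*[y*z]≡y*[x*z] : ∀ x y z → x * (y * z) ≡ y * (x * z)
      x*[y*z]≡y*[x*z] = solve-∀

    s = 6 * T

    x≤2^[s[k+1]] : ∀ k → x k ≤ 2 ^ (s * suc k)
    x≤2^[s[k+1]] k = begin
      x k                 ≤⟨ x≤6T^k k ⟩
      6 * T ^ suc k       ≤⟨ 6T^k≤[6T]^k k ⟩
      s ^ suc k           ≤⟨ ^-monoˡ-≤ (suc k) (<⇒≤ (n<2^n s)) ⟩
      (2 ^ s) ^ suc k     ≡⟨ ^-*-assoc 2 s (suc k) ⟩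
      2 ^ (s * suc k)     ∎
      where open ≤-Reasoning

  geometric-witnesses⇒log-count : ∃[ c ] 1 ≤ c × ∃[ N₀ ] ∀ N → N₀ ≤ N → ⌊log₂ N ⌋ ≤ c * count P? N
  geometric-witnesses⇒log-count = 2 * s , 1≤2s , 2 ^ s , λ N 2^s≤N →
    ⌊log₂⌋≤-from-exponential-growth s {{>-nonZero 1≤s}} (count P?) counted 2^s≤N
    where
    1≤s : 1 ≤ s
    1≤s = ≤-trans (s≤s z≤n) (≤-trans 125≤T (m≤n*m T 6))
    1≤2s : 1 ≤ 2 * s
    1≤2s = ≤-trans 1≤s (m≤m+n s _)
    counted : ∀ k {N} → 2 ^ (s * suc k) ≤ N → suc k ≤ count P? N
    counted k 2^≤N = increasing⇒count P? x P[x] x-increasing x-positive k (≤-trans (x≤2^[s[k+1]] k) 2^≤N)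

factorial-split : ∀ {p} → Prime p → ∀ m d → d < p → ∃[ w ] (d + p * m) ! ≡ p ^ m * m ! * w × p ∤ w
factorial-split {p} pr zero zero _ = 1 , cong _! (*-zeroʳ p) , prime∤1 pr
factorial-split {zero} _ (suc m) zero ()
factorial-split {suc p′} pr (suc m) zero _ with factorial-split pr m p′ ≤-refl
... | w , eq , p∤w = w , eq′ , p∤w
  where
  p = suc p′
  eq′ : (0 + p * suc m) ! ≡ p ^ suc m * suc m ! * w
  eq′ = begin
    (p * suc m) !                      ≡⟨ cong _! (*-suc p m) ⟩
    (p + p * m) * (p′ + p * m) !       ≡⟨ cong ((p + p * m) *_) eq ⟩
    (p + p * m) * (p ^ m * m ! * w)    ≡⟨ rearrange p m (p ^ m) (m !) w ⟩
    p * p ^ m * (suc m * m !) * w      ∎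
    where
    open ≡-Reasoning
    rearrange : ∀ p m a f w → (p + p * m) * (a * f * w) ≡ p * a * (suc m * f) * w
    rearrange = solve-∀
factorial-split {p} pr m (suc d) d<p with factorial-split pr m d (<⇒≤ d<p)
... | w , eq , p∤w = suc (d + p * m) * w , eq′ , prime∤-* pr p∤x p∤w
  where
  eq′ : (suc d + p * m) ! ≡ p ^ m * m ! * (suc (d + p * m) * w)
  eq′ = begin
    suc (d + p * m) * (d + p * m) !       ≡⟨ cong (suc (d + p * m) *_) eq ⟩
    suc (d + p * m) * (p ^ m * m ! * w)   ≡⟨ rearrange (suc (d + p * m)) (p ^ m * m !) w ⟩
    p ^ m * m ! * (suc (d + p * m) * w)   ∎
    where
    open ≡-Reasoning
    rearrange : ∀ x a w → x * (a * w) ≡ a * (x * w)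
    rearrange = solve-∀
  p∤x : p ∤ suc d + p * m
  p∤x p∣x = <⇒≱ d<p (∣⇒≤ (∣m+n∣m⇒∣n (subst (p ∣_) (+-comm (suc d) (p * m)) p∣x) (m∣m*n m)))

base : ℕ → ℕ
base h = suc (2 * h)

data LowDigits (h : ℕ) : ℕ → Set where
  []  : LowDigits h 0
  _∷_ : ∀ {d m} → d ≤ h → LowDigits h m → LowDigits h (d + base h * m)

record CentralFactorialSplit (p n : ℕ) : Set where
  field
    e u v : ℕ
    [2n]!≡ : (2 * n) ! ≡ p ^ e * p ^ e * u
    n!≡    : n ! ≡ p ^ e * v
    p∤u    : p ∤ u
    p∤v    : p ∤ v

module _ {h : ℕ} (p-prime : Prime (base h)) where

  private
    p = base h

  lowDigits⇒centralFactorialSplit : ∀ {n} → LowDigits h n → CentralFactorialSplit p n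
  lowDigits⇒centralFactorialSplit [] = record
    { e = 0 ; u = 1 ; v = 1 ; [2n]!≡ = refl ; n!≡ = refl ; p∤u = prime∤1 p-prime ; p∤v = prime∤1 p-prime }
  lowDigits⇒centralFactorialSplit (_∷_ {d} {m} d≤h low-m)
    with lowDigits⇒centralFactorialSplit low-m
       | factorial-split p-prime (2 * m) (2 * d) (s≤s (*-monoʳ-≤ 2 d≤h))
       | factorial-split p-prime m d (s≤s (≤-trans d≤h (m≤m+n h (h + 0))))
  ... | record { e = e ; u = u ; v = v ; [2n]!≡ = [2m]!≡ ; n!≡ = m!≡ ; p∤u = p∤u ; p∤v = p∤v }
      | w₁ , [2n]!≡′ , p∤w₁ | w₂ , n!≡′ , p∤w₂ = record
    { e = m + e ; u = u * w₁ ; v = v * w₂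
    ; [2n]!≡ = [2n]!≡ ; n!≡ = n!≡
    ; p∤u = prime∤-* p-prime p∤u p∤w₁ ; p∤v = prime∤-* p-prime p∤v p∤w₂ }
    where
    open ≡-Reasoning
    p^[m+e] : p ^ (m + e) ≡ p ^ m * p ^ e
    p^[m+e] = ^-distribˡ-+-* p m e
    [2n]!≡ : (2 * (d + p * m)) ! ≡ p ^ (m + e) * p ^ (m + e) * (u * w₁)
    [2n]!≡ = begin
      (2 * (d + p * m)) !                       ≡⟨ cong _! (double-digit d p m) ⟩
      (2 * d + p * (2 * m)) !                   ≡⟨ [2n]!≡′ ⟩
      p ^ (m + (m + 0)) * (2 * m) ! * w₁        ≡⟨ cong₂ (λ a b → a * b * w₁) (^-distribˡ-+-* p m (m + 0)) [2m]!≡ ⟩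
      p ^ m * p ^ (m + 0) * (p ^ e * p ^ e * u) * w₁
        ≡⟨ cong (λ k → p ^ m * p ^ k * (p ^ e * p ^ e * u) * w₁) (+-identityʳ m) ⟩
      p ^ m * p ^ m * (p ^ e * p ^ e * u) * w₁  ≡⟨ rearrange (p ^ m) (p ^ e) u w₁ ⟩
      p ^ m * p ^ e * (p ^ m * p ^ e) * (u * w₁) ≡⟨ cong (λ a → a * a * (u * w₁)) (sym p^[m+e]) ⟩
      p ^ (m + e) * p ^ (m + e) * (u * w₁)      ∎
      where
      double-digit : ∀ d p m → 2 * (d + p * m) ≡ 2 * d + p * (2 * m)
      double-digit = solve-∀
      rearrange : ∀ a b u w → a * a * (b * b * u) * w ≡ a * b * (a * b) * (u * w)
      rearrange = solve-∀
    n!≡ : (d + p * m) ! ≡ p ^ (m + e) * (v * w₂)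
    n!≡ = begin
      (d + p * m) !                  ≡⟨ n!≡′ ⟩
      p ^ m * m ! * w₂               ≡⟨ cong (λ x → p ^ m * x * w₂) m!≡ ⟩
      p ^ m * (p ^ e * v) * w₂       ≡⟨ rearrange (p ^ m) (p ^ e) v w₂ ⟩
      p ^ m * p ^ e * (v * w₂)       ≡⟨ cong (_* (v * w₂)) (sym p^[m+e]) ⟩
      p ^ (m + e) * (v * w₂)         ∎
      where
      rearrange : ∀ a b v w → a * (b * v) * w ≡ a * b * (v * w)
      rearrange = solve-∀

[2n]Cn*[n!*n!]≡[2n]! : ∀ n → ((2 * n) C n) * (n ! * n !) ≡ (2 * n) !
[2n]Cn*[n!*n!]≡[2n]! n = begin
  ((2 * n) C n) * (n ! * n !)                 ≡⟨ cong (λ k → ((2 * n) C n) * (n ! * k !)) (sym 2n∸n≡n) ⟩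
  ((2 * n) C n) * (n ! * (2 * n ∸ n) !)       ≡⟨ cong (_* (n ! * (2 * n ∸ n) !)) (nCk≡n!/k![n-k]! n≤2n) ⟩
  ((2 * n) ! / (n ! * (2 * n ∸ n) !)) {{n!*m!≢0}} * (n ! * (2 * n ∸ n) !)
                                            ≡⟨ m/n*n≡m {{n!*m!≢0}} (k![n∸k]!∣n! n≤2n) ⟩
  (2 * n) !                                 ∎
  where
  open ≡-Reasoning
  n!*m!≢0 = n !* (2 * n ∸ n) !≢0
  n≤2n : n ≤ 2 * n
  n≤2n = m≤m+n n (n + 0)
  2n∸n≡n : 2 * n ∸ n ≡ n
  2n∸n≡n = trans (m+n∸m≡n n (n + 0)) (+-identityʳ n)

lowDigits⇒prime∤[2n]Cn : ∀ {h n} → Prime (base h) → LowDigits h n → base h ∤ (2 * n) C n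
lowDigits⇒prime∤[2n]Cn {h} {n} p-prime low-n p∣C = p∤u (subst (p ∣_) C*v*v≡u (∣-trans p∣C (m∣m*n (v * v))))
  where
  p = base h
  open CentralFactorialSplit (lowDigits⇒centralFactorialSplit p-prime low-n)
  instance
    p^e*p^e≢0 : NonZero (p ^ e * p ^ e)
    p^e*p^e≢0 = m*n≢0 (p ^ e) (p ^ e) {{m^n≢0 p e}} {{m^n≢0 p e}}
  C*v*v≡u : ((2 * n) C n) * (v * v) ≡ u
  C*v*v≡u = *-cancelˡ-≡ _ _ (p ^ e * p ^ e) (begin
    p ^ e * p ^ e * (((2 * n) C n) * (v * v)) ≡⟨ rearrange (p ^ e) ((2 * n) C n) v ⟩
    ((2 * n) C n) * (p ^ e * v * (p ^ e * v)) ≡⟨ cong (λ x → ((2 * n) C n) * (x * x)) (sym n!≡) ⟩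
    ((2 * n) C n) * (n ! * n !)               ≡⟨ [2n]Cn*[n!*n!]≡[2n]! n ⟩
    (2 * n) !                               ≡⟨ [2n]!≡ ⟩
    p ^ e * p ^ e * u                       ∎)
    where
    open ≡-Reasoning
    rearrange : ∀ a c v → a * a * (c * (v * v)) ≡ c * (a * v * (a * v))
    rearrange = solve-∀

even⊎odd : ∀ n → (∃[ h ] n ≡ 2 * h) ⊎ (∃[ h ] n ≡ base h)
even⊎odd zero = inj₁ (0 , refl)
even⊎odd (suc n) with even⊎odd n
... | inj₁ (h , n≡2h)    = inj₂ (h , cong suc n≡2h)
... | inj₂ (h , n≡1+2h)  = inj₁ (suc h , trans (cong suc n≡1+2h) (sym (*-suc 2 h)))

odd-prime : ∀ {p} → Prime p → p ≢ 2 → ∃[ h ] p ≡ base h × 1 ≤ h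
odd-prime {p} p-prime p≢2 with even⊎odd p
... | inj₁ (h , p≡2h) with prime⇒irreducible p-prime (divides h (trans p≡2h (*-comm 2 h)))
...   | inj₁ ()
...   | inj₂ 2≡p = contradiction (sym 2≡p) p≢2
odd-prime p-prime p≢2 | inj₂ (zero , refl) = contradiction refl (nonTrivial⇒≢1 {{prime⇒nonTrivial p-prime}})
odd-prime p-prime p≢2 | inj₂ (suc h , p≡base) = suc h , p≡base , s≤s z≤n

repdigit : ℕ → ℕ → ℕ
repdigit h zero    = 0
repdigit h (suc j) = h + base h * repdigit h j

base^≡1+2*repdigit : ∀ h j → base h ^ j ≡ suc (2 * repdigit h j)
base^≡1+2*repdigit h zero    = refl
base^≡1+2*repdigit h (suc j) = trans (cong (base h *_) (base^≡1+2*repdigit h j)) (rearrange h (repdigit h j))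
  where
  rearrange : ∀ h r → suc (2 * h) * suc (2 * r) ≡ suc (2 * (h + suc (2 * h) * r))
  rearrange = solve-∀

repdigit-≤-suc : ∀ h j → repdigit h j ≤ repdigit h (suc j)
repdigit-≤-suc h j = ≤-trans (m≤n*m (repdigit h j) (base h)) (m≤n+m _ h)

repdigit-mono-≤ : ∀ h {j′ j} → j′ ≤ j → repdigit h j′ ≤ repdigit h j
repdigit-mono-≤ h j′≤j = go (≤⇒≤′ j′≤j)
  where
  go : ∀ {j′ j} → j′ ≤′ j → repdigit h j′ ≤ repdigit h j
  go ≤′-refl = ≤-refl
  go (≤′-step {j} j′≤′j) = ≤-trans (go j′≤′j) (repdigit-≤-suc h j)

j≤repdigit : ∀ {h} → 1 ≤ h → ∀ j → j ≤ repdigit h j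
j≤repdigit 1≤h zero    = z≤n
j≤repdigit {h} 1≤h (suc j) = +-mono-≤ 1≤h (≤-trans (j≤repdigit 1≤h j) (m≤n*m (repdigit h j) (base h)))

repdigit-sparse : ∀ {h l j} → 2 ≤ h → repdigit h l < repdigit h j → 4 * repdigit h l < repdigit h j
repdigit-sparse {h} {l} {j} 2≤h Rₗ<Rⱼ with j ≤? l
... | yes j≤l = contradiction (repdigit-mono-≤ h j≤l) (<⇒≱ Rₗ<Rⱼ)
... | no j≰l = <-≤-trans (4Rₗ<Rₗ₊₁ h (repdigit h l) 2≤h) (repdigit-mono-≤ h (≰⇒> j≰l))
  where
  4Rₗ<Rₗ₊₁ : ∀ h r → 2 ≤ h → 4 * r < h + base h * r
  4Rₗ<Rₗ₊₁ (suc zero) r (s≤s ())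
  4Rₗ<Rₗ₊₁ (suc (suc h)) r _ = ≤-trans (m≤m+n _ _) (≤-reflexive (rearrange h r))
    where
    rearrange : ∀ h r → suc (4 * r) + (suc h + suc (2 * h) * r) ≡ suc (suc h) + suc (2 * suc (suc h)) * r
    rearrange = solve-∀

lowDigits-1 : ∀ {h} → 1 ≤ h → LowDigits h 1
lowDigits-1 {h} 1≤h = subst (LowDigits h) (cong (1 +_) (*-zeroʳ (base h))) (1≤h ∷ [])

lowDigits-shift : ∀ {h w} j → LowDigits h w → LowDigits h (base h ^ j * w)
lowDigits-shift {h} {w} zero low-w = subst (LowDigits h) (sym (*-identityˡ w)) low-w
lowDigits-shift {h} {w} (suc j) low-w =
  subst (LowDigits h) (sym (*-assoc (base h) (base h ^ j) w)) (z≤n ∷ lowDigits-shift j low-w)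

lowDigits-shift-fill : ∀ {h w} j → LowDigits h w → LowDigits h (base h ^ j * w + repdigit h j)
lowDigits-shift-fill {h} {w} zero low-w = subst (LowDigits h) (sym (trans (+-identityʳ _) (*-identityˡ w))) low-w
lowDigits-shift-fill {h} {w} (suc j) low-w =
  subst (LowDigits h) (rearrange h (base h ^ j) w (repdigit h j)) (≤-refl ∷ lowDigits-shift-fill j low-w)
  where
  rearrange : ∀ h q w r → h + suc (2 * h) * (q * w + r) ≡ suc (2 * h) * q * w + (h + suc (2 * h) * r)
  rearrange = solve-∀

-- For consecutive elements w, w + 1 of the set, lo is the largest element extending w by
-- level digits and hi the smallest extending w + 1; no element lies strictly between them.
record Gap (h : ℕ) : Set where
  constructor gap
  field
    level index : ℕ
    low-index   : LowDigits h index
    low-next    : LowDigits h (suc index)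

  lo hi size : ℕ
  lo   = base h ^ level * index + repdigit h level
  hi   = base h ^ level * suc index
  size = suc (repdigit h level)

open Gap

module _ {h : ℕ} (g : Gap h) where

  hi≡lo+size : hi g ≡ lo g + size g
  hi≡lo+size = begin
    base h ^ j * suc w                          ≡⟨ cong (_* suc w) (base^≡1+2*repdigit h j) ⟩
    suc (2 * R) * suc w                         ≡⟨ rearrange R w ⟩
    suc (2 * R) * w + R + suc R                 ≡⟨ cong (λ q → q * w + R + suc R) (sym (base^≡1+2*repdigit h j)) ⟩
    base h ^ j * w + R + suc R                  ∎
    where
    open ≡-Reasoning
    j = level g
    w = index g
    R = repdigit h j
    rearrange : ∀ r w → suc (2 * r) * suc w ≡ suc (2 * r) * w + r + suc r
    rearrange = solve-∀

  lowDigits-lo : LowDigits h (lo g)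
  lowDigits-lo = lowDigits-shift-fill (level g) (low-index g)

  lowDigits-hi : LowDigits h (hi g)
  lowDigits-hi = lowDigits-shift (level g) (low-next g)

size-double : ∀ {h} → 1 ≤ h → ∀ {j′ j} → j′ < j → suc (repdigit h j′) + suc (repdigit h j′) ≤ suc (repdigit h j)
size-double {suc h} _ {j′} {suc j} (s≤s j′≤j) = begin
  suc R′ + suc R′                             ≤⟨ +-mono-≤ (s≤s R′≤R) (s≤s R′≤R) ⟩
  suc R + suc R                               ≤⟨ m≤m+n _ _ ⟩
  suc R + suc R + (h + suc (2 * h) * R)       ≡⟨ rearrange h R ⟩
  suc (suc h + suc (2 * suc h) * R)           ∎
  where
  open ≤-Reasoning
  R′ = repdigit (suc h) j′
  R = repdigit (suc h) j
  R′≤R = repdigit-mono-≤ (suc h) j′≤j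
  rearrange : ∀ h r → suc r + suc r + (h + suc (2 * h) * r) ≡ suc (suc h + suc (2 * suc h) * r)
  rearrange = solve-∀

locate-in-blocks : ∀ Q K R t {x} → Q * K ≤ x → x ≤ Q * (t + K) + R →
  (∃[ d ] d ≤ t × Q * (d + K) ≤ x × x ≤ Q * (d + K) + R) ⊎
  (∃[ d ] d < t × Q * (d + K) + R < x × x < Q * (suc d + K))
locate-in-blocks Q K R zero    QK≤x x≤end = inj₁ (0 , z≤n , QK≤x , x≤end)
locate-in-blocks Q K R (suc t) {x} QK≤x x≤end with x ≤? Q * (t + K) + R
... | yes x≤end′ with locate-in-blocks Q K R t QK≤x x≤end′
...   | inj₁ (d , d≤t , lo≤x , x≤hi) = inj₁ (d , m≤n⇒m≤1+n d≤t , lo≤x , x≤hi)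
...   | inj₂ (d , d<t , lo<x , x<hi) = inj₂ (d , m≤n⇒m≤1+n d<t , lo<x , x<hi)
locate-in-blocks Q K R (suc t) {x} QK≤x x≤end | no x≰end′ with x <? Q * (suc t + K)
... | yes x<start = inj₂ (t , ≤-refl , ≰⇒> x≰end′ , x<start)
... | no x≮start  = inj₁ (suc t , ≤-refl , ≮⇒≥ x≮start , x≤end)

-- hi+R≤b keeps the block after the gap inside [a, b]; probe-left uses it to compare sizes.
record GapAround (h j a b x : ℕ) : Set where
  field
    around   : Gap h
    level<   : level around < j
    a≤lo     : a ≤ lo around
    hi+R≤b   : hi around + repdigit h (level around) ≤ b
    lo<x     : lo around < x
    x<hi     : x < hi around

gapAround-widen : ∀ {h j j′ a a′ b b′ x} → j ≤ j′ → a′ ≤ a → b ≤ b′ → GapAround h j a b x → GapAround h j′ a′ b′ x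
gapAround-widen j≤j′ a′≤a b≤b′ g = record
  { around = around ; level< = <-≤-trans level< j≤j′ ; a≤lo = ≤-trans a′≤a a≤lo
  ; hi+R≤b = ≤-trans hi+R≤b b≤b′ ; lo<x = lo<x ; x<hi = x<hi }
  where open GapAround g

lowDigits⊎gapAround : ∀ {h u} j {x} → LowDigits h u →
  base h ^ j * u ≤ x → x ≤ base h ^ j * u + repdigit h j →
  LowDigits h x ⊎ GapAround h j (base h ^ j * u) (base h ^ j * u + repdigit h j) x
lowDigits⊎gapAround {h} {u} zero {x} low-u start≤x x≤end =
  inj₁ (subst (LowDigits h) (≤-antisym u≤x x≤u) low-u)
  where
  u≤x : u ≤ x
  u≤x = subst (_≤ x) (*-identityˡ u) start≤x
  x≤u : x ≤ u
  x≤u = subst (x ≤_) (trans (+-identityʳ _) (*-identityˡ u)) x≤end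
lowDigits⊎gapAround {h} {u} (suc j) {x} low-u start≤x x≤end =
  [ child-block , between-children ]′ (locate-in-blocks Q K R h (subst (_≤ x) start≡ start≤x) (subst (x ≤_) end≡ x≤end))
  where
  open ≡-Reasoning
  Q = base h ^ j
  K = base h * u
  R = repdigit h j
  start = base h ^ suc j * u
  end = start + repdigit h (suc j)
  start≡ : start ≡ Q * K
  start≡ = rearrange (base h) Q u
    where
    rearrange : ∀ b q u → b * q * u ≡ q * (b * u)
    rearrange = solve-∀
  end≡ : end ≡ Q * (h + K) + R
  end≡ = begin
    base h * Q * u + (h + base h * R)              ≡⟨ cong (λ q → base h * q * u + (h + base h * R)) (base^≡1+2*repdigit h j) ⟩
    base h * suc (2 * R) * u + (h + base h * R)    ≡⟨ rearrange h R u ⟩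
    suc (2 * R) * (h + K) + R                      ≡⟨ cong (λ q → q * (h + K) + R) (sym (base^≡1+2*repdigit h j)) ⟩
    Q * (h + K) + R                                ∎
    where
    rearrange : ∀ h r u → suc (2 * h) * suc (2 * r) * u + (h + suc (2 * h) * r) ≡ suc (2 * r) * (h + suc (2 * h) * u) + r
    rearrange = solve-∀
  start≤child : ∀ d → start ≤ Q * (d + K)
  start≤child d = subst (_≤ Q * (d + K)) (sym start≡) (*-monoʳ-≤ Q (m≤n+m K d))
  child≤end : ∀ {d} → d ≤ h → Q * (d + K) + R ≤ end
  child≤end {d} d≤h = subst (Q * (d + K) + R ≤_) (sym end≡) (+-monoˡ-≤ R (*-monoʳ-≤ Q (+-monoˡ-≤ K d≤h)))

  Result = LowDigits h x ⊎ GapAround h (suc j) start end x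

  child-block : ∃[ d ] d ≤ h × Q * (d + K) ≤ x × x ≤ Q * (d + K) + R → Result
  child-block (d , d≤h , lo≤x , x≤hi) with lowDigits⊎gapAround j (d≤h ∷ low-u) lo≤x x≤hi
  ... | inj₁ low-x = inj₁ low-x
  ... | inj₂ g = inj₂ (gapAround-widen (n≤1+n j) (start≤child d) (child≤end d≤h) g)

  between-children : ∃[ d ] d < h × Q * (d + K) + R < x × x < Q * (suc d + K) → Result
  between-children (d , d<h , lo<x , x<hi) = inj₂ (record
    { around = gap j (d + K) (<⇒≤ d<h ∷ low-u) (d<h ∷ low-u)
    ; level< = ≤-refl
    ; a≤lo = ≤-trans (start≤child d) (m≤m+n _ R)
    ; hi+R≤b = child≤end d<h
    ; lo<x = lo<x
    ; x<hi = x<hi })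

Common : ℕ → ℕ → ℕ → Set
Common h₁ h₂ n = LowDigits h₁ n × LowDigits h₂ n

Linked : ∀ {h₁ h₂} → Gap h₁ → Gap h₂ → Set
Linked g₁ g₂ = lo g₁ < lo g₂ × lo g₂ < hi g₁ × hi g₁ < hi g₂

CommonNear : ∀ {h₁ h₂} → Gap h₁ → Gap h₂ → Set
CommonNear {h₁} {h₂} g₁ g₂ =
  ∃[ n ] Common h₁ h₂ n × lo g₁ ≤ n + (size g₁ + size g₂) × n ≤ hi g₂ + (size g₁ + size g₂)

-- f bounds the sum of the levels; every refinement step lowers it.
Descent : ℕ → Set
Descent f = ∀ {h₁ h₂} → 1 ≤ h₁ → 1 ≤ h₂ → (g₁ : Gap h₁) (g₂ : Gap h₂) →
            level g₁ + level g₂ < f → Linked g₁ g₂ → CommonNear g₁ g₂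

module _ {h₁ h₂} (g₁ : Gap h₁) (g₂ : Gap h₂) where

  private
    R₁ = repdigit h₁ (level g₁)
    R₂ = repdigit h₂ (level g₂)

  probe-right : Linked g₁ g₂ → R₂ ≤ R₁ →
                LowDigits h₁ (hi g₂) ⊎ ∃[ g₁′ ] level g₁′ < level g₁ × Linked g₂ g₁′
  probe-right (lo₁<lo₂ , lo₂<hi₁ , hi₁<hi₂) R₂≤R₁
    with lowDigits⊎gapAround (level g₁) (low-next g₁) (<⇒≤ hi₁<hi₂) hi₂≤hi₁+R₁
    where
    hi₂≤hi₁+R₁ : hi g₂ ≤ hi g₁ + R₁
    hi₂≤hi₁+R₁ = begin
      hi g₂              ≡⟨ trans (hi≡lo+size g₂) (+-suc (lo g₂) R₂) ⟩
      suc (lo g₂) + R₂   ≤⟨ +-mono-≤ lo₂<hi₁ R₂≤R₁ ⟩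
      hi g₁ + R₁         ∎
      where open ≤-Reasoning
  ... | inj₁ low = inj₁ low
  ... | inj₂ record { around = g₁′ ; level< = j′<j ; a≤lo = hi₁≤lo₁′ ; lo<x = lo₁′<hi₂ ; x<hi = hi₂<hi₁′ } =
    inj₂ (g₁′ , j′<j , <-≤-trans lo₂<hi₁ hi₁≤lo₁′ , lo₁′<hi₂ , hi₂<hi₁′)

  probe-left : Linked g₁ g₂ → R₁ < R₂ →
               LowDigits h₂ (lo g₁) ⊎ ∃[ g₂′ ] level g₂′ < level g₂ × size g₂′ ≤ size g₁ × Linked g₂′ g₁
  probe-left (lo₁<lo₂ , lo₂<hi₁ , hi₁<hi₂) R₁<R₂
    with lowDigits⊎gapAround (level g₂) (low-index g₂) start≤lo₁ (<⇒≤ lo₁<lo₂)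
    where
    lo₂≤lo₁+R₁ : lo g₂ ≤ lo g₁ + R₁
    lo₂≤lo₁+R₁ = ≤-pred (≤-trans lo₂<hi₁ (≤-reflexive (trans (hi≡lo+size g₁) (+-suc (lo g₁) R₁))))
    start≤lo₁ : base h₂ ^ level g₂ * index g₂ ≤ lo g₁
    start≤lo₁ = +-cancelʳ-≤ R₂ _ _ (≤-trans lo₂≤lo₁+R₁ (+-monoʳ-≤ (lo g₁) (<⇒≤ R₁<R₂)))
  ... | inj₁ low = inj₁ low
  ... | inj₂ record { around = g₂′ ; level< = i′<i ; hi+R≤b = hi₂′+R₂′≤lo₂ ; lo<x = lo₂′<lo₁ ; x<hi = lo₁<hi₂′ } =
    inj₂ (g₂′ , i′<i , s₂′≤s₁ , lo₂′<lo₁ , lo₁<hi₂′ , ≤-<-trans (≤-trans (m≤m+n _ _) hi₂′+R₂′≤lo₂) lo₂<hi₁)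
    where
    R₂′ = repdigit h₂ (level g₂′)
    s₂′≤s₁ : size g₂′ ≤ size g₁
    s₂′≤s₁ = +-cancelˡ-≤ (lo g₁) _ _ (begin
      lo g₁ + size g₂′           ≡⟨ +-suc (lo g₁) R₂′ ⟩
      suc (lo g₁) + R₂′          ≤⟨ +-monoˡ-≤ R₂′ lo₁<hi₂′ ⟩
      hi g₂′ + R₂′               ≤⟨ hi₂′+R₂′≤lo₂ ⟩
      lo g₂                      ≤⟨ <⇒≤ lo₂<hi₁ ⟩
      hi g₁                      ≡⟨ hi≡lo+size g₁ ⟩
      lo g₁ + size g₁            ∎)
      where open ≤-Reasoning

module _ {f} (descent : Descent f) {h₁ h₂} (1≤h₁ : 1 ≤ h₁) (1≤h₂ : 1 ≤ h₂)
         (g₁ : Gap h₁) (g₂ : Gap h₂) (levels<f : level g₁ + level g₂ < suc f) (linked : Linked g₁ g₂) where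

  private
    s₁ = size g₁
    s₂ = size g₂
    open ≤-Reasoning
    lo₁≤hi₂ : lo g₁ ≤ hi g₂
    lo₁≤hi₂ = let (lo₁<lo₂ , lo₂<hi₁ , hi₁<hi₂) = linked in <⇒≤ (<-trans lo₁<lo₂ (<-trans lo₂<hi₁ hi₁<hi₂))

  descend-right : repdigit h₂ (level g₂) ≤ repdigit h₁ (level g₁) → CommonNear g₁ g₂
  descend-right R₂≤R₁ with probe-right g₁ g₂ linked R₂≤R₁
  ... | inj₁ low = hi g₂ , (low , lowDigits-hi g₂) , ≤-trans lo₁≤hi₂ (m≤m+n _ _) , m≤m+n _ _
  ... | inj₂ (g₁′ , j′<j , linked′@(_ , lo₁′<hi₂ , _)) with descent 1≤h₂ 1≤h₁ g₂ g₁′ levels′<f linked′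
    where
    levels′<f : level g₂ + level g₁′ < f
    levels′<f = ≤-trans (+-monoʳ-< (level g₂) j′<j) (subst (_≤ f) (+-comm (level g₁) (level g₂)) (≤-pred levels<f))
  ... | n , common , lo₂≤ , ≤hi₁′ = n , swap common , lo₁≤ , ≤hi₂
    where
    s₁′ = size g₁′
    lo₁≤ : lo g₁ ≤ n + (s₁ + s₂)
    lo₁≤ = begin
      lo g₁             ≤⟨ <⇒≤ (proj₁ linked) ⟩
      lo g₂             ≤⟨ lo₂≤ ⟩
      n + (s₂ + s₁′)    ≤⟨ +-monoʳ-≤ n (+-monoʳ-≤ s₂ (s≤s (repdigit-mono-≤ h₁ (<⇒≤ j′<j)))) ⟩
      n + (s₂ + s₁)     ≡⟨ cong (n +_) (+-comm s₂ s₁) ⟩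
      n + (s₁ + s₂)     ∎
    ≤hi₂ : n ≤ hi g₂ + (s₁ + s₂)
    ≤hi₂ = begin
      n                              ≤⟨ ≤hi₁′ ⟩
      hi g₁′ + (s₂ + s₁′)            ≡⟨ cong (_+ (s₂ + s₁′)) (hi≡lo+size g₁′) ⟩
      lo g₁′ + s₁′ + (s₂ + s₁′)      ≤⟨ +-monoˡ-≤ (s₂ + s₁′) (+-monoˡ-≤ s₁′ (<⇒≤ lo₁′<hi₂)) ⟩
      hi g₂ + s₁′ + (s₂ + s₁′)       ≡⟨ rearrange (hi g₂) s₁′ s₂ ⟩
      hi g₂ + (s₁′ + s₁′ + s₂)       ≤⟨ +-monoʳ-≤ (hi g₂) (+-monoˡ-≤ s₂ (size-double 1≤h₁ j′<j)) ⟩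
      hi g₂ + (s₁ + s₂)              ∎
      where
      rearrange : ∀ a b c → a + b + (c + b) ≡ a + (b + b + c)
      rearrange = solve-∀

  descend-left : repdigit h₁ (level g₁) < repdigit h₂ (level g₂) → CommonNear g₁ g₂
  descend-left R₁<R₂ with probe-left g₁ g₂ linked R₁<R₂
  ... | inj₁ low = lo g₁ , (lowDigits-lo g₁ , low) , m≤m+n _ _ , ≤-trans lo₁≤hi₂ (m≤m+n _ _)
  ... | inj₂ (g₂′ , i′<i , _ , linked′@(_ , lo₁<hi₂′ , _)) with descent 1≤h₂ 1≤h₁ g₂′ g₁ levels′<f linked′
    where
    levels′<f : level g₂′ + level g₁ < f
    levels′<f = ≤-trans (+-monoˡ-< (level g₁) i′<i) (subst (_≤ f) (+-comm (level g₁) (level g₂)) (≤-pred levels<f))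
  ... | n , common , lo₂′≤ , ≤hi₁ = n , swap common , lo₁≤ , ≤hi₂
    where
    s₂′ = size g₂′
    lo₁≤ : lo g₁ ≤ n + (s₁ + s₂)
    lo₁≤ = begin
      lo g₁                          ≤⟨ <⇒≤ lo₁<hi₂′ ⟩
      hi g₂′                         ≡⟨ hi≡lo+size g₂′ ⟩
      lo g₂′ + s₂′                   ≤⟨ +-monoˡ-≤ s₂′ lo₂′≤ ⟩
      n + (s₂′ + s₁) + s₂′           ≡⟨ rearrange n s₂′ s₁ ⟩
      n + (s₂′ + s₂′ + s₁)           ≤⟨ +-monoʳ-≤ n (+-monoˡ-≤ s₁ (size-double 1≤h₂ i′<i)) ⟩
      n + (s₂ + s₁)                  ≡⟨ cong (n +_) (+-comm s₂ s₁) ⟩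
      n + (s₁ + s₂)                  ∎
      where
      rearrange : ∀ a b c → a + (b + c) + b ≡ a + (b + b + c)
      rearrange = solve-∀
    ≤hi₂ : n ≤ hi g₂ + (s₁ + s₂)
    ≤hi₂ = begin
      n                     ≤⟨ ≤hi₁ ⟩
      hi g₁ + (s₂′ + s₁)    ≤⟨ +-mono-≤ (<⇒≤ (proj₂ (proj₂ linked))) (+-monoˡ-≤ s₁ (s≤s (repdigit-mono-≤ h₂ (<⇒≤ i′<i)))) ⟩
      hi g₂ + (s₂ + s₁)     ≡⟨ cong (hi g₂ +_) (+-comm s₂ s₁) ⟩
      hi g₂ + (s₁ + s₂)     ∎

descent : ∀ f → Descent f
descent zero _ _ _ _ ()
descent (suc f) 1≤h₁ 1≤h₂ g₁ g₂ levels<f linked with repdigit _ (level g₂) ≤? repdigit _ (level g₁)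
... | yes R₂≤R₁ = descend-right (descent f) 1≤h₁ 1≤h₂ g₁ g₂ levels<f linked R₂≤R₁
... | no R₂≰R₁  = descend-left (descent f) 1≤h₁ 1≤h₂ g₁ g₂ levels<f linked (≰⇒> R₂≰R₁)

linked⇒commonNear : ∀ {h₁ h₂} → 1 ≤ h₁ → 1 ≤ h₂ → (g₁ : Gap h₁) (g₂ : Gap h₂) → Linked g₁ g₂ → CommonNear g₁ g₂
linked⇒commonNear 1≤h₁ 1≤h₂ g₁ g₂ = descent (suc (level g₁ + level g₂)) 1≤h₁ 1≤h₂ g₁ g₂ ≤-refl

Anchored : ℕ → ℕ → ℕ → ℕ → Set
Anchored h₁ h₂ c S = ∃[ n ] Common h₁ h₂ n × S ≤ 4 * suc n × n ≤ c * S

window-lower : ∀ {S R n t} → S ≡ suc (2 * R) → S ≤ n + t → 2 * t ≤ 3 * suc R → S ≤ 4 * suc n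
window-lower {R = R} {n} {t} refl S≤n+t 2t≤3[R+1] =
  ≤-trans (s≤s (*-monoʳ-≤ 2 R≤2n+1)) (≤-trans (n≤1+n _) (≤-reflexive (4[n+1] n)))
  where
  R≤2n+1 : R ≤ suc (2 * n)
  R≤2n+1 = +-cancelʳ-≤ (2 + 3 * R) R (suc (2 * n)) (begin
    R + (2 + 3 * R)              ≡⟨ rearrangeˡ R ⟩
    2 * suc (2 * R)              ≤⟨ *-monoʳ-≤ 2 S≤n+t ⟩
    2 * (n + t)                  ≡⟨ *-distribˡ-+ 2 n t ⟩
    2 * n + 2 * t                ≤⟨ +-monoʳ-≤ (2 * n) 2t≤3[R+1] ⟩
    2 * n + 3 * suc R            ≡⟨ rearrangeʳ n R ⟩
    suc (2 * n) + (2 + 3 * R)    ∎)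
    where
    open ≤-Reasoning
    rearrangeˡ : ∀ R → R + (2 + 3 * R) ≡ 2 * suc (2 * R)
    rearrangeˡ = solve-∀
    rearrangeʳ : ∀ n R → 2 * n + 3 * suc R ≡ suc (2 * n) + (2 + 3 * R)
    rearrangeʳ = solve-∀
  4[n+1] : ∀ n → suc (suc (2 * suc (2 * n))) ≡ 4 * suc n
  4[n+1] = solve-∀

window-upper : ∀ {S R n} → S ≡ suc (2 * R) → n ≤ S + R + 2 * suc R → n ≤ 3 * S
window-upper {R = R} refl n≤ = ≤-trans n≤ (≤-trans (m≤m+n _ R) (≤-reflexive (rearrange R)))
  where
  rearrange : ∀ R → suc (2 * R) + R + 2 * suc R + R ≡ 3 * suc (2 * R)
  rearrange = solve-∀

module NearPower {h₁ h₂} (1≤h₁ : 1 ≤ h₁) (1≤h₂ : 1 ≤ h₂) (l : ℕ) where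

  R = repdigit h₁ l
  S = base h₁ ^ l * 1
  e = S + R

  S≡1+2R : S ≡ suc (2 * R)
  S≡1+2R = trans (*-identityʳ _) (base^≡1+2*repdigit h₁ l)

  Outcome : Set
  Outcome = Anchored h₁ h₂ 3 S ⊎ ∃[ i ] R < repdigit h₂ i × repdigit h₂ i < S

  anchored : ∀ {n} t → Common h₁ h₂ n → S ≤ n + t → 2 * t ≤ 3 * suc R → n ≤ e + 2 * suc R → Outcome
  anchored _ common S≤n+t 2t≤ n≤ = inj₁ (_ , common , window-lower S≡1+2R S≤n+t 2t≤ , window-upper S≡1+2R n≤)

  anchored-inside : ∀ {n} → Common h₁ h₂ n → S ≤ n → n ≤ e → Outcome
  anchored-inside {n} common S≤n n≤e =
    anchored 0 common (≤-trans S≤n (m≤m+n n 0)) z≤n (≤-trans n≤e (m≤m+n e _))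

  module _ (g₁ : Gap h₁) (g₂ : Gap h₂) (j<l : level g₁ < l) (S≤lo₁ : S ≤ lo g₁) (hi₁≤e : hi g₁ ≤ e)
           (lo₂≤e : lo g₂ ≤ e) (linked : Linked g₁ g₂) where

    private
      s₁ = size g₁
      s₂ = size g₂
      2s₁≤R+1 : s₁ + s₁ ≤ suc R
      2s₁≤R+1 = size-double 1≤h₁ j<l
      open ≤-Reasoning

    from-linked-right : repdigit h₂ (level g₂) ≤ repdigit h₁ (level g₁) → Outcome
    from-linked-right R₂≤R₁ with linked⇒commonNear 1≤h₁ 1≤h₂ g₁ g₂ linked
    ... | n , common , lo₁≤ , ≤hi₂ = anchored (s₁ + s₂) common (≤-trans S≤lo₁ lo₁≤) 2t≤ n≤
      where
      s₁+s₂≤R+1 : s₁ + s₂ ≤ suc R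
      s₁+s₂≤R+1 = ≤-trans (+-monoʳ-≤ s₁ (s≤s R₂≤R₁)) 2s₁≤R+1
      2t≤ : 2 * (s₁ + s₂) ≤ 3 * suc R
      2t≤ = *-mono-≤ (n≤1+n 2) s₁+s₂≤R+1
      n≤ : n ≤ e + 2 * suc R
      n≤ = begin
        n                          ≤⟨ ≤hi₂ ⟩
        hi g₂ + (s₁ + s₂)          ≡⟨ cong (_+ (s₁ + s₂)) (hi≡lo+size g₂) ⟩
        lo g₂ + s₂ + (s₁ + s₂)     ≤⟨ +-mono-≤ (+-mono-≤ lo₂≤e (≤-trans (m≤n+m s₂ s₁) s₁+s₂≤R+1)) s₁+s₂≤R+1 ⟩
        e + suc R + suc R          ≡⟨ rearrange e (suc R) ⟩
        e + 2 * suc R              ∎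
        where
        rearrange : ∀ a b → a + b + b ≡ a + 2 * b
        rearrange = solve-∀

    from-linked-left : repdigit h₁ (level g₁) < repdigit h₂ (level g₂) → Outcome
    from-linked-left R₁<R₂ with probe-left g₁ g₂ linked R₁<R₂
    ... | inj₁ low = anchored-inside (lowDigits-lo g₁ , low) S≤lo₁ (≤-trans (m≤m+n (lo g₁) s₁) (≤-trans (≤-reflexive (sym (hi≡lo+size g₁))) hi₁≤e))
    ... | inj₂ (g₂′ , _ , s₂′≤s₁ , linked′@(_ , lo₁<hi₂′ , _)) with linked⇒commonNear 1≤h₂ 1≤h₁ g₂′ g₁ linked′
    ...   | n , common , lo₂′≤ , ≤hi₁ = anchored (s₁ + s₁ + s₁) (swap common) S≤n+t 2t≤ n≤
      where
      s₂′ = size g₂′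
      S≤n+t : S ≤ n + (s₁ + s₁ + s₁)
      S≤n+t = begin
        S                          ≤⟨ S≤lo₁ ⟩
        lo g₁                      ≤⟨ <⇒≤ lo₁<hi₂′ ⟩
        hi g₂′                     ≡⟨ hi≡lo+size g₂′ ⟩
        lo g₂′ + s₂′               ≤⟨ +-mono-≤ lo₂′≤ s₂′≤s₁ ⟩
        n + (s₂′ + s₁) + s₁        ≤⟨ +-monoˡ-≤ s₁ (+-monoʳ-≤ n (+-monoˡ-≤ s₁ s₂′≤s₁)) ⟩
        n + (s₁ + s₁) + s₁         ≡⟨ +-assoc n (s₁ + s₁) s₁ ⟩
        n + (s₁ + s₁ + s₁)         ∎
      2t≤ : 2 * (s₁ + s₁ + s₁) ≤ 3 * suc R
      2t≤ = ≤-trans (≤-reflexive (rearrange s₁)) (*-monoʳ-≤ 3 2s₁≤R+1)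
        where
        rearrange : ∀ s → 2 * (s + s + s) ≡ 3 * (s + s)
        rearrange = solve-∀
      n≤ : n ≤ e + 2 * suc R
      n≤ = begin
        n                          ≤⟨ ≤hi₁ ⟩
        hi g₁ + (s₂′ + s₁)         ≤⟨ +-mono-≤ hi₁≤e (≤-trans (+-monoˡ-≤ s₁ s₂′≤s₁) 2s₁≤R+1) ⟩
        e + suc R                  ≤⟨ +-monoʳ-≤ e (m≤n*m (suc R) 2) ⟩
        e + 2 * suc R              ∎

    from-linked : Outcome
    from-linked with repdigit h₂ (level g₂) ≤? repdigit h₁ (level g₁)
    ... | yes R₂≤R₁ = from-linked-right R₂≤R₁
    ... | no R₂≰R₁  = from-linked-left (≰⇒> R₂≰R₁)

  from-gap-at-lo₂ : (g₂ : Gap h₂) → S ≤ lo g₂ → lo g₂ < e → e < hi g₂ → Outcome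
  from-gap-at-lo₂ g₂ S≤lo₂ lo₂<e e<hi₂ with lowDigits⊎gapAround l (lowDigits-1 1≤h₁) S≤lo₂ (<⇒≤ lo₂<e)
  ... | inj₁ low = anchored-inside (low , lowDigits-lo g₂) S≤lo₂ (<⇒≤ lo₂<e)
  ... | inj₂ record { around = g₁ ; level< = j<l ; a≤lo = S≤lo₁ ; hi+R≤b = hi₁+R₁≤e ; lo<x = lo₁<lo₂ ; x<hi = lo₂<hi₁ } =
    from-linked g₁ g₂ j<l S≤lo₁ hi₁≤e (<⇒≤ lo₂<e) (lo₁<lo₂ , lo₂<hi₁ , ≤-<-trans hi₁≤e e<hi₂)
    where
    hi₁≤e : hi g₁ ≤ e
    hi₁≤e = ≤-trans (m≤m+n _ _) hi₁+R₁≤e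

  from-gap-at-e : (g₂ : Gap h₂) → lo g₂ < e → e < hi g₂ → Outcome
  from-gap-at-e g₂ lo₂<e e<hi₂ with S ≤? lo g₂
  ... | yes S≤lo₂ = from-gap-at-lo₂ g₂ S≤lo₂ lo₂<e e<hi₂
  ... | no S≰lo₂ = inj₂ (level g₂ , R<R₂ , ≤-<-trans (m≤n+m R₂ _) (≰⇒> S≰lo₂))
    where
    R₂ = repdigit h₂ (level g₂)
    R<R₂ : R < R₂
    R<R₂ = +-cancelˡ-< S R R₂ (begin-strict
      S + R              <⟨ e<hi₂ ⟩
      hi g₂              ≡⟨ trans (hi≡lo+size g₂) (+-suc (lo g₂) R₂) ⟩
      suc (lo g₂) + R₂   ≤⟨ +-monoˡ-≤ R₂ (≰⇒> S≰lo₂) ⟩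
      S + R₂             ∎)
      where open ≤-Reasoning

  outcome : Outcome
  outcome with lowDigits⊎gapAround e [] 0≤e e≤R₂ₑ
    where
    0≤e : base h₂ ^ e * 0 ≤ e
    0≤e = subst (_≤ e) (sym (*-zeroʳ (base h₂ ^ e))) z≤n
    e≤R₂ₑ : e ≤ base h₂ ^ e * 0 + repdigit h₂ e
    e≤R₂ₑ = subst (e ≤_) (cong (_+ repdigit h₂ e) (sym (*-zeroʳ (base h₂ ^ e)))) (j≤repdigit 1≤h₂ e)
  ... | inj₁ low = anchored-inside (lowDigits-shift-fill l (lowDigits-1 1≤h₁) , low) (m≤m+n S R) ≤-refl
  ... | inj₂ record { around = g₂ ; lo<x = lo₂<e ; x<hi = e<hi₂ } = from-gap-at-e g₂ lo₂<e e<hi₂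

-- When NearPower fails for the first set it returns a level i with R < R₂ᵢ ≤ 2R. Restarting
-- from the second set at level i can then only fail through a repdigit of h₁ strictly
-- between R and 4R + 1, which repdigit-sparse excludes.
common-near-power : ∀ {h₁ h₂} → 2 ≤ h₁ → 1 ≤ h₂ → ∀ l → Anchored h₁ h₂ 6 (base h₁ ^ l)
common-near-power {h₁} {h₂} 2≤h₁ 1≤h₂ l = [ widen , reverse ]′ (NearPower.outcome 1≤h₁ 1≤h₂ l)
  where
  1≤h₁ : 1 ≤ h₁
  1≤h₁ = ≤-trans (n≤1+n 1) 2≤h₁
  R = repdigit h₁ l
  S = base h₁ ^ l
  S≡1+2R : S ≡ suc (2 * R)
  S≡1+2R = base^≡1+2*repdigit h₁ l
  S*1≡S : S * 1 ≡ S
  S*1≡S = *-identityʳ S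

  widen : Anchored h₁ h₂ 3 (S * 1) → Anchored h₁ h₂ 6 S
  widen (n , common , S≤ , ≤3S) =
    n , common , subst (_≤ 4 * suc n) S*1≡S S≤ , ≤-trans ≤3S (*-mono-≤ (m≤m+n 3 3) (≤-reflexive S*1≡S))

  reverse : ∃[ i ] R < repdigit h₂ i × repdigit h₂ i < S * 1 → Anchored h₁ h₂ 6 S
  reverse (i , R<R₂ , R₂<S) = [ from-reversed , (λ c → ⊥-elim (impossible c)) ]′ (NearPower.outcome 1≤h₂ 1≤h₁ i)
    where
    R₂ = repdigit h₂ i
    Q = base h₂ ^ i * 1
    Q≡1+2R₂ : Q ≡ suc (2 * R₂)
    Q≡1+2R₂ = NearPower.S≡1+2R 1≤h₂ 1≤h₁ i
    R₂≤2R : R₂ ≤ 2 * R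
    R₂≤2R = ≤-pred (subst (R₂ <_) (trans S*1≡S S≡1+2R) R₂<S)
    S≤Q : S ≤ Q
    S≤Q = subst₂ _≤_ (sym S≡1+2R) (sym Q≡1+2R₂) (s≤s (*-monoʳ-≤ 2 (<⇒≤ R<R₂)))
    Q≤2S : Q ≤ 2 * S
    Q≤2S = begin
      Q                  ≡⟨ Q≡1+2R₂ ⟩
      suc (2 * R₂)       ≤⟨ s≤s (*-monoʳ-≤ 2 R₂≤2R) ⟩
      suc (2 * (2 * R))  ≤⟨ n≤1+n _ ⟩
      2 + 2 * (2 * R)    ≡⟨ sym (*-suc 2 (2 * R)) ⟩
      2 * suc (2 * R)    ≡⟨ cong (2 *_) (sym S≡1+2R) ⟩
      2 * S              ∎
      where open ≤-Reasoning

    from-reversed : Anchored h₂ h₁ 3 Q → Anchored h₁ h₂ 6 S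
    from-reversed (n , common , Q≤ , ≤3Q) =
      n , swap common , ≤-trans S≤Q Q≤ , ≤-trans ≤3Q (≤-trans (*-monoʳ-≤ 3 Q≤2S) (≤-reflexive (sym (*-assoc 3 2 S))))

    impossible : ¬ (∃[ j ] R₂ < repdigit h₁ j × repdigit h₁ j < Q)
    impossible (j , R₂<R₁ⱼ , R₁ⱼ<Q) = <⇒≱ (repdigit-sparse {l = l} {j} 2≤h₁ (<-trans R<R₂ R₂<R₁ⱼ)) (begin
      repdigit h₁ j      ≤⟨ ≤-pred (subst (repdigit h₁ j <_) Q≡1+2R₂ R₁ⱼ<Q) ⟩
      2 * R₂             ≤⟨ *-monoʳ-≤ 2 R₂≤2R ⟩
      2 * (2 * R)        ≡⟨ sym (*-assoc 2 2 R) ⟩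
      4 * R              ∎)
      where open ≤-Reasoning

common⇒gcd≡1 : ∀ {h₁ h₂ n} → Prime (base h₁) → Prime (base h₂) → Common h₁ h₂ n →
               gcd (base h₁ * base h₂) ((2 * n) C n) ≡ 1
common⇒gcd≡1 p-prime q-prime (low₁ , low₂) = coprime⇒gcd≡1 (coprime-*ˡ
  (prime∤⇒coprime p-prime (lowDigits⇒prime∤[2n]Cn p-prime low₁))
  (prime∤⇒coprime q-prime (lowDigits⇒prime∤[2n]Cn q-prime low₂)))

cube-witnesses : ∀ {h₁ h₂} → 2 ≤ h₁ → 1 ≤ h₂ → ∀ k → Anchored h₁ h₂ 6 ((base h₁ ^ 3) ^ suc k)
cube-witnesses {h₁} 2≤h₁ 1≤h₂ k =
  subst (Anchored _ _ 6) (sym (^-*-assoc (base h₁) 3 (suc k))) (common-near-power 2≤h₁ 1≤h₂ (3 * suc k))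

125≤base^3 : ∀ {h} → 2 ≤ h → 125 ≤ base h ^ 3
125≤base^3 2≤h = ^-monoˡ-≤ 3 (s≤s (*-monoʳ-≤ 2 2≤h))

common-witnesses : ∀ {h₁ h₂} → 1 ≤ h₁ → 1 ≤ h₂ → h₁ ≢ h₂ → ∃[ T ] 125 ≤ T × (∀ k → Anchored h₁ h₂ 6 (T ^ suc k))
common-witnesses {h₁} {h₂} 1≤h₁ 1≤h₂ h₁≢h₂ with 2 ≤? h₁ | 2 ≤? h₂
... | yes 2≤h₁ | _       = base h₁ ^ 3 , 125≤base^3 2≤h₁ , cube-witnesses 2≤h₁ 1≤h₂
... | no _     | yes 2≤h₂ = base h₂ ^ 3 , 125≤base^3 2≤h₂ , map₂ (map₁ swap) ∘ cube-witnesses 2≤h₂ 1≤h₁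
... | no 2≰h₁  | no 2≰h₂ = contradiction (trans (h≡1 1≤h₁ 2≰h₁) (sym (h≡1 1≤h₂ 2≰h₂))) h₁≢h₂
  where
  h≡1 : ∀ {h} → 1 ≤ h → ¬ 2 ≤ h → h ≡ 1
  h≡1 1≤h 2≰h = ≤-antisym (≤-pred (≰⇒> 2≰h)) 1≤h

theorem2p4 : (p q : ℕ) → Prime p → Prime q → p ≢ q → p ≢ 2 → q ≢ 2 →
    Σ ℕ λ k → (1 ≤ k) × (Σ ℕ λ N₀ → (N : ℕ) → N₀ ≤ N →
      ⌊log₂ N ⌋ ≤ k * countA p q N)
theorem2p4 p q p-prime q-prime p≢q p≢2 q≢2 with odd-prime p-prime p≢2 | odd-prime q-prime q≢2
... | hp , refl , 1≤hp | hq , refl , 1≤hq with common-witnesses 1≤hp 1≤hq (p≢q ∘ cong base)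
...   | T , 125≤T , witnesses =
  geometric-witnesses⇒log-count (λ n → gcd (p * q) ((2 * n) C n) ≟ 1) 125≤T
    (map₂ (map₁ (common⇒gcd≡1 p-prime q-prime)) ∘ witnesses)
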